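{- Let $w$ be a nonempty string over a totally ordered alphabet of size $\sigma$, and let $\mathsf{OPST}(w)$ be its order-preserving suffix tree (defined in the context). Then every branching node of $\mathsf{OPST}(w)$ has outdegree at most $2\sigma+1=\mathcal{O}(\sigma)$.
   Context: Strings are indexed from $0$; $w=w[0..n-1]$ and $w[i..j]$ is a fragment. The symbol $\perp$ denotes "undefined". For a nonempty string $x$ of length $m$: $p(x)$ is the largest $j\le m-2$ such that $x[j]=\max\{x[k]: k\le m-2,\ x[k]\le x[m-1]\}$, or $\perp$ if no such $j$ exists; $s(x)$ is the largest $j\le m-2$ such that $x[j]=\min\{x[k]: k\le m-2,\ x[k]\ge x[m-1]\}$, or $\perp$ if no such $j$ exists. $\mathsf{LastCode}(x)=(p(x),s(x))$ and $\mathsf{PrefCode}(x)=\mathsf{LastCode}(x[0..0])\cdot\mathsf{LastCode}(x[0..1])\cdots\mathsf{LastCode}(x[0..m-1])$ (a sequence of pairs). Two equal-length strings $x,y$ are order-preserving ($x\approx y$) iff for all $i,j$, $x[i]\le x[j]\iff y[i]\le y[j]$; equivalently $\mathsf{PrefCode}(x)=\mathsf{PrefCode}(y)$. Let $\$$ be a symbol distinct from all pairs. $\mathsf{OPST}(w)$ is the compacted trie of the family of sequences $\{\mathsf{PrefCode}(w[i..n-1])\$ : 0\le i\le n-1\}$. In the underlying (uncompacted) trie every node corresponds to a distinct prefix of one of these sequences; a node is branching if it has at least two children. The outdegree of a branching node is its number of children (equivalently, the number of distinct symbols labelling its outgoing edges in the trie). -}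

module Defs where

open import Data.Nat using (ℕ; zero; suc; _≤_; _≤ᵇ_)
open import Data.Bool using (Bool; true; false; if_then_else_; _∧_; _∨_; not)
open import Data.Fin using (Fin; toℕ)
open import Data.List using (List; []; _∷_; _++_; _∷ʳ_; map; drop; length)
open import Data.Maybe using (Maybe; just; nothing)
open import Data.Product using (_×_; _,_; proj₁; ∃; ∃-syntax)
open import Relation.Binary.PropositionalEquality using (_≡_; _≢_)

-- Symbols of the encoded sequences: a pair (p , s) of optional positions
-- (nothing = ⊥), or the end marker $.
data Sym : Set where
  code   : Maybe ℕ → Maybe ℕ → Sym
  dollar : Sym

-- Left-to-right scan over x[0..m-2] (values vs, starting at index j) keeping
-- the best candidate (index , value) so far.
-- p : candidates v ≤ a; prefer larger value, ties -> larger index.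
pScan : ℕ → ℕ → List ℕ → Maybe (ℕ × ℕ) → Maybe ℕ
pScan a j [] nothing = nothing
pScan a j [] (just (i , _)) = just i
pScan a j (v ∷ vs) nothing =
  pScan a (suc j) vs (if v ≤ᵇ a then just (j , v) else nothing)
pScan a j (v ∷ vs) (just (i , b)) =
  pScan a (suc j) vs (if (v ≤ᵇ a) ∧ (b ≤ᵇ v) then just (j , v) else just (i , b))

-- s : candidates v ≥ a; prefer smaller value, ties -> larger index.
sScan : ℕ → ℕ → List ℕ → Maybe (ℕ × ℕ) → Maybe ℕ
sScan a j [] nothing = nothing
sScan a j [] (just (i , _)) = just i
sScan a j (v ∷ vs) nothing =
  sScan a (suc j) vs (if a ≤ᵇ v then just (j , v) else nothing)
sScan a j (v ∷ vs) (just (i , b)) =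
  sScan a (suc j) vs (if (a ≤ᵇ v) ∧ (v ≤ᵇ b) then just (j , v) else just (i , b))

-- LastCode of the nonempty string  ys ++ [a]  (ys = x[0..m-2], a = x[m-1]).
p s : List ℕ → ℕ → Maybe ℕ
p ys a = pScan a 0 ys nothing
s ys a = sScan a 0 ys nothing

LastCode : List ℕ → ℕ → Sym
LastCode ys a = code (p ys a) (s ys a)

prefCodeAcc : List ℕ → List ℕ → List Sym
prefCodeAcc acc [] = []
prefCodeAcc acc (a ∷ rest) = LastCode acc a ∷ prefCodeAcc (acc ∷ʳ a) rest

PrefCode : List ℕ → List Sym
PrefCode = prefCodeAcc []

-- Strings over an ordered alphabet of size σ: lists of Fin σ, ordered via toℕ.
-- The i-th sequence of the family: PrefCode(w[i..n-1]) $
seqOf : ∀ {σ} → List (Fin σ) → ℕ → List Sym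
seqOf w i = PrefCode (map toℕ (drop i w)) ∷ʳ dollar

-- Nodes of the (uncompacted) trie: prefixes of the sequences, i < n.
IsNode : ∀ {σ} → List (Fin σ) → List Sym → Set
IsNode w u = ∃[ i ] (suc i ≤ length w × ∃[ rest ] (u ++ rest ≡ seqOf w i))

IsChild : ∀ {σ} → List (Fin σ) → List Sym → Sym → Set
IsChild w u c = IsNode w (u ∷ʳ c)

IsBranching : ∀ {σ} → List (Fin σ) → List Sym → Set
IsBranching w u = IsNode w u × ∃[ c₁ ] ∃[ c₂ ] (c₁ ≢ c₂ × IsChild w u c₁ × IsChild w u c₂)

-- A child label of a node u is $ or LastCode ys a, where PrefCode ys ≡ u and a < σ is a letter.
-- PrefCode ys determines ys up to order isomorphism, and for order-isomorphic ys and zs the codes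
-- LastCode ys a and LastCode zs b coincide exactly when a sits among the letters of ys as b sits
-- among those of zs.  That position is measured by the slot r a + r (a + 1), where r t counts the
-- distinct letters of ys below t: it is an order invariant, and it is below 2σ because r t ≤ t.
-- So the labels other than $ inject into 2σ slots.

module Submission where

open import Defs
open import Data.Nat using (ℕ; _≤_; _+_; _*_)
open import Data.Fin using (Fin)
open import Data.List using (List; []; length)
open import Data.List.Relation.Unary.All using (All)
open import Data.List.Relation.Unary.Unique.Propositional using (Unique)
open import Relation.Binary.PropositionalEquality using (_≢_)

open import Data.Nat using (zero; suc; _<_; z≤n; s≤s; s≤s⁻¹; z<s; s<s)
open import Data.Nat.Properties
import Data.Fin as Fin
open import Data.Fin using (toℕ; fromℕ<)
open import Data.Fin.Properties using (toℕ<n; toℕ-fromℕ<; injective⇒≤)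
open import Data.List using (_∷_; _++_; _∷ʳ_; map; drop; lookup)
open import Data.List.Properties using (∷-injectiveˡ; ∷-injectiveʳ; ∷ʳ-++; ++-identityʳ; length-++)
open import Data.List.Membership.Propositional using (_∈_)
open import Data.List.Membership.Propositional.Properties using (∈-lookup; ∈-map⁻)
import Data.List.Relation.Unary.All as All
open import Data.List.Relation.Unary.AllPairs using (_∷_)
open import Data.List.Relation.Unary.Any using (here; there)
open import Data.Bool using (if_then_else_; _∧_)
open import Data.Bool.Properties using (if-float)
open import Data.Maybe using (Maybe; just; nothing)
import Data.Maybe as Maybe
open import Data.Maybe.Properties using (map-∘; map-id)
open import Data.Product using (∃-syntax; _×_; _,_; proj₁; proj₂)
open import Data.Sum using (_⊎_; inj₁; inj₂; [_,_]′)
open import Function using (id; _∘_)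
open import Function.Bundles using (_⇔_; mk⇔; module Equivalence)
open import Function.Construct.Symmetry using (⇔-sym)
open import Function.Properties.Equivalence using (⇔-setoid)
open import Level using (0ℓ)
open import Relation.Binary.Core using (Rel)
open import Relation.Binary.Definitions using (Decidable; tri<; tri≈; tri>)
open import Relation.Binary.Structures using (IsTotalPreorder)
import Relation.Binary.Construct.Flip.EqAndOrd as Flip
import Relation.Binary.Reasoning.Setoid as SetoidReasoning
open import Relation.Binary.PropositionalEquality
  using (_≡_; refl; sym; trans; cong; cong₂; subst; subst₂; module ≡-Reasoning)
open import Relation.Nullary using (¬_; Dec; yes; no; does; contradiction)
open import Relation.Nullary.Decidable using (does-⇔)

open Equivalence using (to; from)

module ⇔-Reasoning = SetoidReasoning (⇔-setoid 0ℓ)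

infixl 5 _!_
infix 4 _≈_

-- Positions past the end read as 0; every use below is guarded by an index bound.
_!_ : List ℕ → ℕ → ℕ
[]       ! _     = 0
(x ∷ xs) ! zero  = x
(x ∷ xs) ! suc i = xs ! i

∷ʳ-!-< : ∀ xs {a i} → i < length xs → (xs ∷ʳ a) ! i ≡ xs ! i
∷ʳ-!-< (x ∷ xs) {i = zero}  _         = refl
∷ʳ-!-< (x ∷ xs) {i = suc i} (s<s i<n) = ∷ʳ-!-< xs i<n

∷ʳ-!-length : ∀ xs {a} → (xs ∷ʳ a) ! length xs ≡ a
∷ʳ-!-length []       = refl
∷ʳ-!-length (x ∷ xs) = ∷ʳ-!-length xs

length-∷ʳ : ∀ (xs : List ℕ) {a} → length (xs ∷ʳ a) ≡ suc (length xs)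
length-∷ʳ xs = trans (length-++ xs) (+-comm (length xs) 1)

all<-suc : ∀ {P : ℕ → Set} {k} → (∀ {t} → t < k → P t) → P k → ∀ {t} → t < suc k → P t
all<-suc below at-k t<1+k with m<1+n⇒m<n∨m≡n t<1+k
... | inj₁ t<k  = below t<k
... | inj₂ refl = at-k

OrderIso : (ℕ → ℕ) → (ℕ → ℕ) → ℕ → Set
OrderIso f g k = ∀ {i j} → i < k → j < k → (f i ≤ f j ⇔ g i ≤ g j)

orderIso-sym : ∀ {f g k} → OrderIso f g k → OrderIso g f k
orderIso-sym iso i<k j<k = ⇔-sym (iso i<k j<k)

orderIso-≡ : ∀ {f g k i j} → OrderIso f g k → i < k → j < k → f i ≡ f j → g i ≡ g j
orderIso-≡ iso i<k j<k fi≡fj =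
  ≤-antisym (to (iso i<k j<k) (≤-reflexive fi≡fj)) (to (iso j<k i<k) (≤-reflexive (sym fi≡fj)))

orderIso-< : ∀ {f g k i j} → OrderIso f g k → i < k → j < k → f i < f j → g i < g j
orderIso-< iso i<k j<k fi<fj = ≰⇒> (λ gj≤gi → <⇒≱ fi<fj (from (iso j<k i<k) gj≤gi))

-- best f a k is the last t < k carrying a ≼-greatest value f t ≼ a:
-- the paper's p for ≼ = ≤ and its s for ≼ = ≥.
module Best {_≼_ : Rel ℕ 0ℓ} (_≼?_ : Decidable _≼_)
            (≼-isTotalPreorder : IsTotalPreorder _≡_ _≼_) where
  open IsTotalPreorder ≼-isTotalPreorder using (total) renaming (refl to ≼-refl; trans to ≼-trans)

  Iso : (ℕ → ℕ) → (ℕ → ℕ) → ℕ → Set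
  Iso f g k = ∀ {i j} → i < k → j < k → (f i ≼ f j ⇔ g i ≼ g j)

  Agree : (ℕ → ℕ) → (ℕ → ℕ) → ℕ → ℕ → ℕ → Set
  Agree f g k a b = ∀ {t} → t < k → (f t ≼ a ⇔ g t ≼ b)

  challenge : (ℕ → ℕ) → ℕ → ℕ → Maybe ℕ → Maybe ℕ
  challenge f a k nothing  = if does (f k ≼? a) then just k else nothing
  challenge f a k (just i) = if does (f k ≼? a) ∧ does (f i ≼? f k) then just k else just i

  best : (ℕ → ℕ) → ℕ → ℕ → Maybe ℕ
  best f a zero    = nothing
  best f a (suc k) = challenge f a k (best f a k)

  -- Says nothing about ties; best-cong handles them by following the computation.
  IsBest : (ℕ → ℕ) → ℕ → ℕ → Maybe ℕ → Set
  IsBest f a k nothing  = ∀ {t} → t < k → ¬ f t ≼ a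
  IsBest f a k (just i) = i < k × f i ≼ a × (∀ {t} → t < k → f t ≼ a → f t ≼ f i)

  ⋠⇒≽ : ∀ {x y} → ¬ x ≼ y → y ≼ x
  ⋠⇒≽ {x} {y} x⋠y = [ (λ x≼y → contradiction x≼y x⋠y) , id ]′ (total x y)

  challenge-isBest : ∀ {f a k m} → IsBest f a k m → IsBest f a (suc k) (challenge f a k m)
  challenge-isBest {f} {a} {k} {nothing} none with f k ≼? a
  ... | yes fk≼a = n<1+n k , fk≼a ,
                   all<-suc (λ t<k ft≼a → contradiction ft≼a (none t<k)) (λ _ → ≼-refl {f k})
  ... | no  fk⋠a = all<-suc none fk⋠a
  challenge-isBest {f} {a} {k} {just i} (i<k , fi≼a , below) with f k ≼? a | f i ≼? f k
  ... | yes fk≼a | yes fi≼fk =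
    n<1+n k , fk≼a , all<-suc (λ t<k ft≼a → ≼-trans (below t<k ft≼a) fi≼fk) (λ _ → ≼-refl {f k})
  ... | yes _    | no  fi⋠fk =
    m<n⇒m<1+n i<k , fi≼a , all<-suc below (λ _ → ⋠⇒≽ fi⋠fk)
  ... | no  fk⋠a | _         =
    m<n⇒m<1+n i<k , fi≼a , all<-suc below (λ fk≼a → contradiction fk≼a fk⋠a)

  best-isBest : ∀ f a k → IsBest f a k (best f a k)
  best-isBest f a zero    = λ ()
  best-isBest f a (suc k) = challenge-isBest (best-isBest f a k)

  ≼best⇔≼ : ∀ {f a k i t} → IsBest f a k (just i) → t < k → (f t ≼ f i ⇔ f t ≼ a)
  ≼best⇔≼ (_ , fi≼a , below) t<k = mk⇔ (λ ft≼fi → ≼-trans ft≼fi fi≼a) (below t<k)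

  isBest-agree : ∀ {f g a b k m} → Iso f g k → IsBest f a k m → IsBest g b k m → Agree f g k a b
  isBest-agree {m = nothing} _ noneᶠ noneᵍ t<k =
    mk⇔ (λ ft≼a → contradiction ft≼a (noneᶠ t<k)) (λ gt≼b → contradiction gt≼b (noneᵍ t<k))
  isBest-agree {f} {g} {a} {b} {m = just i} iso bestᶠ bestᵍ {t} t<k = begin
    f t ≼ a    ≈⟨ ≼best⇔≼ bestᶠ t<k ⟨
    f t ≼ f i  ≈⟨ iso t<k (proj₁ bestᶠ) ⟩
    g t ≼ g i  ≈⟨ ≼best⇔≼ bestᵍ t<k ⟩
    g t ≼ b    ∎
    where open ⇔-Reasoning

  challenge-cong : ∀ {f g a b k m} → (f k ≼ a ⇔ g k ≼ b) →
                   (∀ {i} → i < k → f i ≼ f k ⇔ g i ≼ g k) →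
                   IsBest f a k m → challenge f a k m ≡ challenge g b k m
  challenge-cong {f} {g} {a} {b} {k} {nothing} new _ _ =
    cong (λ c → if c then just k else nothing) (does-⇔ new (f k ≼? a) (g k ≼? b))
  challenge-cong {f} {g} {a} {b} {k} {just i} new old (i<k , _) =
    cong (λ c → if c then just k else just i)
      (cong₂ _∧_ (does-⇔ new (f k ≼? a) (g k ≼? b)) (does-⇔ (old i<k) (f i ≼? f k) (g i ≼? g k)))

  best-cong : ∀ {f g a b} k → Iso f g k → Agree f g k a b → best f a k ≡ best g b k
  best-cong zero _ _ = refl
  best-cong {f} {g} {a} {b} (suc k) iso agree = begin
    challenge f a k (best f a k)  ≡⟨ challenge-cong (agree (n<1+n k)) new-vs-old (best-isBest f a k) ⟩
    challenge g b k (best f a k)  ≡⟨ cong (challenge g b k) (best-cong k iso′ agree′) ⟩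
    challenge g b k (best g b k)  ∎
    where
    open ≡-Reasoning
    iso′ : Iso f g k
    iso′ i<k j<k = iso (m<n⇒m<1+n i<k) (m<n⇒m<1+n j<k)
    agree′ : Agree f g k a b
    agree′ t<k = agree (m<n⇒m<1+n t<k)
    new-vs-old : ∀ {i} → i < k → f i ≼ f k ⇔ g i ≼ g k
    new-vs-old i<k = iso (m<n⇒m<1+n i<k) (n<1+n k)

  best-≡⇔agree : ∀ {f g a b} k → Iso f g k → (best f a k ≡ best g b k ⇔ Agree f g k a b)
  best-≡⇔agree {f} {g} {a} {b} k iso = mk⇔ agree (best-cong k iso)
    where
    agree : best f a k ≡ best g b k → Agree f g k a b
    agree eq = isBest-agree iso (best-isBest f a k) (subst (IsBest g b k) (sym eq) (best-isBest g b k))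

  step : ℕ → ℕ → ℕ → Maybe (ℕ × ℕ) → Maybe (ℕ × ℕ)
  step a j v nothing        = if does (v ≼? a) then just (j , v) else nothing
  step a j v (just (i , b)) = if does (v ≼? a) ∧ does (b ≼? v) then just (j , v) else just (i , b)

  scan : ℕ → ℕ → List ℕ → Maybe (ℕ × ℕ) → Maybe ℕ
  scan a j []       acc = Maybe.map proj₁ acc
  scan a j (v ∷ vs) acc = scan a (suc j) vs (step a j v acc)

  withValue : (ℕ → ℕ) → Maybe ℕ → Maybe (ℕ × ℕ)
  withValue f = Maybe.map (λ i → i , f i)

  step-challenge : ∀ f a j m → step a j (f j) (withValue f m) ≡ withValue f (challenge f a j m)
  step-challenge f a j nothing  = sym (if-float (withValue f) (does (f j ≼? a)))
  step-challenge f a j (just i) = sym (if-float (withValue f) (does (f j ≼? a) ∧ does (f i ≼? f j)))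

  scan-best : ∀ f a j vs → (∀ {t} → t < length vs → vs ! t ≡ f (j + t)) →
              scan a j vs (withValue f (best f a j)) ≡ best f a (j + length vs)
  scan-best f a j [] _ = begin
    Maybe.map proj₁ (withValue f (best f a j))  ≡⟨ map-∘ (best f a j) ⟨
    Maybe.map id (best f a j)                   ≡⟨ map-id (best f a j) ⟩
    best f a j                                  ≡⟨ cong (best f a) (+-identityʳ j) ⟨
    best f a (j + 0)                            ∎
    where open ≡-Reasoning
  scan-best f a j (v ∷ vs) vs! = begin
    scan a (suc j) vs (step a j v current)
      ≡⟨ cong (λ x → scan a (suc j) vs (step a j x current)) v≡fj ⟩
    scan a (suc j) vs (step a j (f j) current)
      ≡⟨ cong (scan a (suc j) vs) (step-challenge f a j (best f a j)) ⟩
    scan a (suc j) vs (withValue f (best f a (suc j)))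
      ≡⟨ scan-best f a (suc j) vs shifted ⟩
    best f a (suc j + length vs)
      ≡⟨ cong (best f a) (+-suc j (length vs)) ⟨
    best f a (j + suc (length vs))
      ∎
    where
    open ≡-Reasoning
    current : Maybe (ℕ × ℕ)
    current = withValue f (best f a j)
    v≡fj : v ≡ f j
    v≡fj = trans (vs! z<s) (cong f (+-identityʳ j))
    shifted : ∀ {t} → t < length vs → vs ! t ≡ f (suc j + t)
    shifted {t} t<n = trans (vs! (s<s t<n)) (cong f (+-suc j t))

module Floor   = Best _≤?_ ≤-isTotalPreorder
module Ceiling = Best _≥?_ (Flip.isTotalPreorder ≤-isTotalPreorder)

pScan≡scan : ∀ a j vs acc → pScan a j vs acc ≡ Floor.scan a j vs acc
pScan≡scan a j []       nothing        = refl
pScan≡scan a j []       (just (i , b)) = refl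
pScan≡scan a j (v ∷ vs) nothing        = pScan≡scan a (suc j) vs _
pScan≡scan a j (v ∷ vs) (just (i , b)) = pScan≡scan a (suc j) vs _

sScan≡scan : ∀ a j vs acc → sScan a j vs acc ≡ Ceiling.scan a j vs acc
sScan≡scan a j []       nothing        = refl
sScan≡scan a j []       (just (i , b)) = refl
sScan≡scan a j (v ∷ vs) nothing        = sScan≡scan a (suc j) vs _
sScan≡scan a j (v ∷ vs) (just (i , b)) = sScan≡scan a (suc j) vs _

p≡best : ∀ ys a {k} → length ys ≡ k → p ys a ≡ Floor.best (ys !_) a k
p≡best ys a refl = trans (pScan≡scan a 0 ys nothing) (Floor.scan-best (ys !_) a 0 ys (λ _ → refl))

s≡best : ∀ ys a {k} → length ys ≡ k → s ys a ≡ Ceiling.best (ys !_) a k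
s≡best ys a refl = trans (sScan≡scan a 0 ys nothing) (Ceiling.scan-best (ys !_) a 0 ys (λ _ → refl))

SamePlace : (ℕ → ℕ) → (ℕ → ℕ) → ℕ → ℕ → ℕ → Set
SamePlace f g k a b = Floor.Agree f g k a b × Ceiling.Agree f g k a b

record _≈_ (ys zs : List ℕ) : Set where
  constructor mk≈
  field
    length-≡ : length ys ≡ length zs
    orderIso : OrderIso (ys !_) (zs !_) (length ys)

code-injective : ∀ {x y x′ y′} → code x y ≡ code x′ y′ → x ≡ x′ × y ≡ y′
code-injective refl = refl , refl

lastCode-≡⇔samePlace : ∀ {ys zs a b} → ys ≈ zs →
                       (LastCode ys a ≡ LastCode zs b ⇔ SamePlace (ys !_) (zs !_) (length ys) a b)
lastCode-≡⇔samePlace {ys} {zs} {a} {b} (mk≈ len iso) = mk⇔ samePlace lastCode≡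
  where
  k = length ys
  floor : Floor.best (ys !_) a k ≡ Floor.best (zs !_) b k ⇔ Floor.Agree (ys !_) (zs !_) k a b
  floor = Floor.best-≡⇔agree k iso
  ceiling : Ceiling.best (ys !_) a k ≡ Ceiling.best (zs !_) b k ⇔ Ceiling.Agree (ys !_) (zs !_) k a b
  ceiling = Ceiling.best-≡⇔agree k (λ i<k j<k → iso j<k i<k)
  samePlace : LastCode ys a ≡ LastCode zs b → SamePlace (ys !_) (zs !_) k a b
  samePlace eq =
    to floor (trans (sym (p≡best ys a refl)) (trans p≡ (p≡best zs b (sym len)))) ,
    to ceiling (trans (sym (s≡best ys a refl)) (trans s≡ (s≡best zs b (sym len))))
    where
    p≡ = proj₁ (code-injective eq)
    s≡ = proj₂ (code-injective eq)
  lastCode≡ : SamePlace (ys !_) (zs !_) k a b → LastCode ys a ≡ LastCode zs b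
  lastCode≡ (floorAgree , ceilingAgree) = cong₂ code
    (trans (p≡best ys a refl) (trans (from floor floorAgree) (sym (p≡best zs b (sym len)))))
    (trans (s≡best ys a refl) (trans (from ceiling ceilingAgree) (sym (s≡best zs b (sym len)))))

orderIso-extend : ∀ {f g k} → OrderIso f g k → SamePlace f g k (f k) (g k) → OrderIso f g (suc k)
orderIso-extend iso (floor , ceiling) i<1+k j<1+k
  with m<1+n⇒m<n∨m≡n i<1+k | m<1+n⇒m<n∨m≡n j<1+k
... | inj₁ i<k  | inj₁ j<k  = iso i<k j<k
... | inj₁ i<k  | inj₂ refl = floor i<k
... | inj₂ refl | inj₁ j<k  = ceiling j<k
... | inj₂ refl | inj₂ refl = mk⇔ (λ _ → ≤-refl) (λ _ → ≤-refl)

module _ {f f′ g g′ : ℕ → ℕ} {k : ℕ}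
         (f≗ : ∀ {i} → i < k → f i ≡ f′ i) (g≗ : ∀ {i} → i < k → g i ≡ g′ i) where

  orderIso-cong : OrderIso f g k → OrderIso f′ g′ k
  orderIso-cong iso i<k j<k =
    subst₂ _⇔_ (cong₂ _≤_ (f≗ i<k) (f≗ j<k)) (cong₂ _≤_ (g≗ i<k) (g≗ j<k)) (iso i<k j<k)

  samePlace-cong : ∀ {a b} → SamePlace f g k a b → SamePlace f′ g′ k a b
  samePlace-cong {a} {b} (floor , ceiling) =
    (λ t<k → subst₂ _⇔_ (cong (_≤ a) (f≗ t<k)) (cong (_≤ b) (g≗ t<k)) (floor t<k)) ,
    (λ t<k → subst₂ _⇔_ (cong (a ≤_) (f≗ t<k)) (cong (b ≤_) (g≗ t<k)) (ceiling t<k))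

≈-∷ʳ : ∀ {ys zs a b} → ys ≈ zs → SamePlace (ys !_) (zs !_) (length ys) a b →
       ys ∷ʳ a ≈ zs ∷ʳ b
≈-∷ʳ {ys} {zs} {a} {b} (mk≈ len iso) same = mk≈
  (trans (length-∷ʳ ys) (trans (cong suc len) (sym (length-∷ʳ zs))))
  (subst (OrderIso ((ys ∷ʳ a) !_) ((zs ∷ʳ b) !_)) (sym (length-∷ʳ ys)) (orderIso-extend iso′ same′))
  where
  k = length ys
  ys≗ : ∀ {i} → i < k → ys ! i ≡ (ys ∷ʳ a) ! i
  ys≗ i<k = sym (∷ʳ-!-< ys i<k)
  zs≗ : ∀ {i} → i < k → zs ! i ≡ (zs ∷ʳ b) ! i
  zs≗ i<k = sym (∷ʳ-!-< zs (subst (_ <_) len i<k))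
  iso′ : OrderIso ((ys ∷ʳ a) !_) ((zs ∷ʳ b) !_) k
  iso′ = orderIso-cong ys≗ zs≗ iso
  same′ : SamePlace ((ys ∷ʳ a) !_) ((zs ∷ʳ b) !_) k ((ys ∷ʳ a) ! k) ((zs ∷ʳ b) ! k)
  same′ = subst₂ (SamePlace ((ys ∷ʳ a) !_) ((zs ∷ʳ b) !_) k)
            (sym (∷ʳ-!-length ys)) (sym (trans (cong ((zs ∷ʳ b) !_) len) (∷ʳ-!-length zs)))
            (samePlace-cong ys≗ zs≗ same)

prefCodeAcc-≈ : ∀ {acc acc′} xs xs′ → acc ≈ acc′ →
                prefCodeAcc acc xs ≡ prefCodeAcc acc′ xs′ → acc ++ xs ≈ acc′ ++ xs′
prefCodeAcc-≈ {acc} {acc′} [] [] acc≈ _ =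
  subst₂ _≈_ (sym (++-identityʳ acc)) (sym (++-identityʳ acc′)) acc≈
prefCodeAcc-≈ [] (_ ∷ _) _ ()
prefCodeAcc-≈ (_ ∷ _) [] _ ()
prefCodeAcc-≈ {acc} {acc′} (x ∷ xs) (x′ ∷ xs′) acc≈ eq =
  subst₂ _≈_ (∷ʳ-++ acc x xs) (∷ʳ-++ acc′ x′ xs′)
    (prefCodeAcc-≈ xs xs′ (≈-∷ʳ acc≈ (to (lastCode-≡⇔samePlace acc≈) (∷-injectiveˡ eq)))
                   (∷-injectiveʳ eq))

prefCode-≈ : ∀ {ys zs} → PrefCode ys ≡ PrefCode zs → ys ≈ zs
prefCode-≈ {ys} {zs} = prefCodeAcc-≈ ys zs (mk≈ refl (λ ()))

Occurs : (ℕ → ℕ) → ℕ → ℕ → Set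
Occurs f k v = ∃[ i ] i < k × f i ≡ v

occurs? : ∀ f k v → Dec (Occurs f k v)
occurs? f k v = anyUpTo? (λ i → f i ≟ v) k

occurs-weaken : ∀ {f k v} → Occurs f k v → Occurs f (suc k) v
occurs-weaken (i , i<k , fi≡v) = i , m<n⇒m<1+n i<k , fi≡v

occurs-suc⇔ : ∀ {f k v} → (f k ≡ v → Occurs f k v) → (Occurs f (suc k) v ⇔ Occurs f k v)
occurs-suc⇔ {f} {k} {v} absorb = mk⇔ shrink occurs-weaken
  where
  shrink : Occurs f (suc k) v → Occurs f k v
  shrink (i , i<1+k , fi≡v) with m<1+n⇒m<n∨m≡n i<1+k
  ... | inj₁ i<k  = i , i<k , fi≡v
  ... | inj₂ refl = absorb fi≡v

occurs-transport : ∀ {f g k} → OrderIso f g (suc k) → Occurs f k (f k) → Occurs g k (g k)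
occurs-transport iso (i , i<k , fi≡fk) = i , i<k , orderIso-≡ iso (m<n⇒m<1+n i<k) (n<1+n _) fi≡fk

rank : (ℕ → ℕ) → ℕ → ℕ → ℕ
rank f k zero    = zero
rank f k (suc v) with occurs? f k v
... | yes _ = suc (rank f k v)
... | no  _ = rank f k v

rank-occurs : ∀ {f k v} → Occurs f k v → rank f k (suc v) ≡ suc (rank f k v)
rank-occurs {f} {k} {v} occ with occurs? f k v
... | yes _    = refl
... | no  ¬occ = contradiction occ ¬occ

rank-fresh : ∀ {f k v} → ¬ Occurs f k v → rank f k (suc v) ≡ rank f k v
rank-fresh {f} {k} {v} ¬occ with occurs? f k v
... | yes occ = contradiction occ ¬occ
... | no  _   = refl

rank-suc-≤ : ∀ f k v → rank f k (suc v) ≤ suc (rank f k v)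
rank-suc-≤ f k v with occurs? f k v
... | yes _ = ≤-refl
... | no  _ = n≤1+n _

rank-≤-rank-suc : ∀ f k v → rank f k v ≤ rank f k (suc v)
rank-≤-rank-suc f k v with occurs? f k v
... | yes _ = n≤1+n _
... | no  _ = ≤-refl

rank-≤ : ∀ f k v → rank f k v ≤ v
rank-≤ f k zero    = z≤n
rank-≤ f k (suc v) = ≤-trans (rank-suc-≤ f k v) (s≤s (rank-≤ f k v))

rank-mono : ∀ {f k v w} → v ≤ w → rank f k v ≤ rank f k w
rank-mono {w = zero} z≤n = ≤-refl
rank-mono {f} {k} {v} {suc w} v≤1+w with m≤n⇒m<n∨m≡n v≤1+w
... | inj₁ v<1+w = ≤-trans (rank-mono (s≤s⁻¹ v<1+w)) (rank-≤-rank-suc f k w)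
... | inj₂ refl  = ≤-refl

rank-< : ∀ {f k t v} → t < k → f t < v → rank f k (f t) < rank f k v
rank-< {f} {k} {t} {v} t<k ft<v = begin-strict
  rank f k (f t)        <⟨ n<1+n _ ⟩
  suc (rank f k (f t))  ≡⟨ rank-occurs (t , t<k , refl) ⟨
  rank f k (suc (f t))  ≤⟨ rank-mono ft<v ⟩
  rank f k v            ∎
  where open ≤-Reasoning

<⇔rank< : ∀ {f k t v} → t < k → (f t < v ⇔ rank f k (f t) < rank f k v)
<⇔rank< t<k = mk⇔ (rank-< t<k) (λ r< → ≰⇒> (λ v≤ft → <⇒≱ r< (rank-mono v≤ft)))

≤⇔rank≤ : ∀ {f k t v} → t < k → (v ≤ f t ⇔ rank f k v ≤ rank f k (f t))
≤⇔rank≤ t<k = mk⇔ rank-mono (λ r≤ → ≮⇒≥ (λ ft<v → <⇒≱ (rank-< t<k ft<v) r≤))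

rank-suc-shift : ∀ {f g k l v} d → (Occurs f k v ⇔ Occurs g l v) →
                 rank f k v ≡ d + rank g l v → rank f k (suc v) ≡ d + rank g l (suc v)
rank-suc-shift {f} {g} {k} {l} {v} d occ⇔ eq with occurs? f k v | occurs? g l v
... | yes _    | yes _    = trans (cong suc eq) (sym (+-suc d _))
... | no  _    | no  _    = eq
... | yes occ  | no  ¬occ = contradiction (to occ⇔ occ) ¬occ
... | no  ¬occ | yes occ  = contradiction (from occ⇔ occ) ¬occ

rank-cong-occurs : ∀ {f g k l} a → (∀ {v} → v < a → Occurs f k v ⇔ Occurs g l v) →
                   rank f k a ≡ rank g l a
rank-cong-occurs zero    _    = refl
rank-cong-occurs (suc a) occ⇔ =
  rank-suc-shift 0 (occ⇔ (n<1+n a)) (rank-cong-occurs a (λ v<a → occ⇔ (m<n⇒m<1+n v<a)))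

rank-empty : ∀ f a → rank f 0 a ≡ 0
rank-empty f zero = refl
rank-empty f (suc a) with occurs? f 0 a
... | no _ = rank-empty f a

rank-extend-≡ : ∀ {f k} a → Occurs f k (f k) ⊎ a ≤ f k → rank f (suc k) a ≡ rank f k a
rank-extend-≡ {f} {k} a old = rank-cong-occurs a (λ v<a → occurs-suc⇔ (absorb v<a))
  where
  absorb : ∀ {v} → v < a → f k ≡ v → Occurs f k v
  absorb v<a refl = [ id , (λ a≤fk → contradiction v<a (≤⇒≯ a≤fk)) ]′ old

rank-extend-fresh : ∀ {f k} a → ¬ Occurs f k (f k) → f k < a → rank f (suc k) a ≡ suc (rank f k a)
rank-extend-fresh {f} {k} (suc a) fresh fk<1+a with m≤n⇒m<n∨m≡n (s≤s⁻¹ fk<1+a)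
... | inj₁ fk<a = rank-suc-shift 1 (occurs-suc⇔ (λ fk≡a → contradiction fk≡a (<⇒≢ fk<a)))
                                   (rank-extend-fresh a fresh fk<a)
... | inj₂ refl = begin
  rank f (suc k) (suc (f k))  ≡⟨ rank-occurs {f} (k , n<1+n k , refl) ⟩
  suc (rank f (suc k) (f k))  ≡⟨ cong suc (rank-extend-≡ (f k) (inj₂ ≤-refl)) ⟩
  suc (rank f k (f k))        ≡⟨ cong suc (rank-fresh fresh) ⟨
  suc (rank f k (suc (f k)))  ∎
  where open ≡-Reasoning

rank-extend-cong : ∀ {f g k a b} → (Occurs f k (f k) ⇔ Occurs g k (g k)) → (f k < a ⇔ g k < b) →
                   rank f k a ≡ rank g k b → rank f (suc k) a ≡ rank g (suc k) b
rank-extend-cong {f} {g} {k} {a} {b} old⇔ new⇔ eq with occurs? f k (f k) | f k <? a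
... | yes old | _ = begin
  rank f (suc k) a  ≡⟨ rank-extend-≡ a (inj₁ old) ⟩
  rank f k a        ≡⟨ eq ⟩
  rank g k b        ≡⟨ rank-extend-≡ b (inj₁ (to old⇔ old)) ⟨
  rank g (suc k) b  ∎
  where open ≡-Reasoning
... | no fresh | yes fk<a = begin
  rank f (suc k) a  ≡⟨ rank-extend-fresh a fresh fk<a ⟩
  suc (rank f k a)  ≡⟨ cong suc eq ⟩
  suc (rank g k b)  ≡⟨ rank-extend-fresh b (fresh ∘ from old⇔) (to new⇔ fk<a) ⟨
  rank g (suc k) b  ∎
  where open ≡-Reasoning
... | no fresh | no fk≮a = begin
  rank f (suc k) a  ≡⟨ rank-extend-≡ a (inj₂ (≮⇒≥ fk≮a)) ⟩
  rank f k a        ≡⟨ eq ⟩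
  rank g k b        ≡⟨ rank-extend-≡ b (inj₂ (≮⇒≥ (fk≮a ∘ from new⇔))) ⟨
  rank g (suc k) b  ∎
  where open ≡-Reasoning

rank-cong : ∀ {f g} k {a b} → OrderIso f g k → (∀ {t} → t < k → f t < a ⇔ g t < b) →
            rank f k a ≡ rank g k b
rank-cong {f} {g} zero {a} {b} _ _ = trans (rank-empty f a) (sym (rank-empty g b))
rank-cong (suc k) iso below = rank-extend-cong
  (mk⇔ (occurs-transport iso) (occurs-transport (orderIso-sym iso)))
  (below (n<1+n k))
  (rank-cong k (λ i<k j<k → iso (m<n⇒m<1+n i<k) (m<n⇒m<1+n j<k)) (λ t<k → below (m<n⇒m<1+n t<k)))

rank-at-cong : ∀ {f g k j} → OrderIso f g k → j < k → rank f k (f j) ≡ rank g k (g j)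
rank-at-cong {k = k} iso j<k =
  rank-cong k iso (λ t<k → mk⇔ (orderIso-< iso t<k j<k) (orderIso-< (orderIso-sym iso) t<k j<k))

-- Even slots are the gaps between consecutive distinct values of f[0..k), odd slots the values.
slot : (ℕ → ℕ) → ℕ → ℕ → ℕ
slot f k a = rank f k a + rank f k (suc a)

slot-< : ∀ {f k a σ} → a < σ → slot f k a < 2 * σ
slot-< {f} {k} {a} {σ} a<σ = begin-strict
  slot f k a  ≤⟨ +-mono-≤ (rank-≤ f k a) (rank-≤ f k (suc a)) ⟩
  a + suc a   <⟨ +-mono-≤ a<σ a<σ ⟩
  σ + σ       ≡⟨ cong (σ +_) (+-identityʳ σ) ⟨
  2 * σ       ∎
  where open ≤-Reasoning

sum-<-of-near : ∀ {l u l′ u′} → l < l′ → u ≤ suc l → l′ ≤ u′ → l + u < l′ + u′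
sum-<-of-near {l} {u} {l′} {u′} l<l′ u≤1+l l′≤u′ = begin-strict
  l + u          ≤⟨ +-monoʳ-≤ l u≤1+l ⟩
  l + suc l      <⟨ n<1+n _ ⟩
  suc l + suc l  ≤⟨ +-mono-≤ l<l′ (≤-trans l<l′ l′≤u′) ⟩
  l′ + u′        ∎
  where open ≤-Reasoning

sum-of-near-injective : ∀ {l u l′ u′} → l ≤ u → u ≤ suc l → l′ ≤ u′ → u′ ≤ suc l′ →
                        l + u ≡ l′ + u′ → l ≡ l′ × u ≡ u′
sum-of-near-injective {l} {u} {l′} {u′} l≤u u≤1+l l′≤u′ u′≤1+l′ eq with <-cmp l l′
... | tri< l<l′ _ _ = contradiction eq (<⇒≢ (sum-<-of-near l<l′ u≤1+l l′≤u′))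
... | tri> _ _ l′<l = contradiction (sym eq) (<⇒≢ (sum-<-of-near l′<l u′≤1+l′ l≤u))
... | tri≈ _ refl _ = refl , +-cancelˡ-≡ l u u′ eq

slot-samePlace : ∀ {f g} k {a b} → OrderIso f g k → slot f k a ≡ slot g k b → SamePlace f g k a b
slot-samePlace {f} {g} k {a} {b} iso eq = floor , ceiling
  where
  ranks≡ : rank f k a ≡ rank g k b × rank f k (suc a) ≡ rank g k (suc b)
  ranks≡ = sum-of-near-injective (rank-≤-rank-suc f k a) (rank-suc-≤ f k a)
                                 (rank-≤-rank-suc g k b) (rank-suc-≤ g k b) eq
  open ⇔-Reasoning
  floor : Floor.Agree f g k a b
  floor {t} t<k = begin
    f t ≤ a                            ≈⟨ mk⇔ s≤s s≤s⁻¹ ⟩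
    f t < suc a                        ≈⟨ <⇔rank< t<k ⟩
    rank f k (f t) < rank f k (suc a)  ≡⟨ cong₂ _<_ (rank-at-cong iso t<k) (proj₂ ranks≡) ⟩
    rank g k (g t) < rank g k (suc b)  ≈⟨ <⇔rank< t<k ⟨
    g t < suc b                        ≈⟨ mk⇔ s≤s s≤s⁻¹ ⟨
    g t ≤ b                            ∎
  ceiling : Ceiling.Agree f g k a b
  ceiling {t} t<k = begin
    a ≤ f t                      ≈⟨ ≤⇔rank≤ t<k ⟩
    rank f k a ≤ rank f k (f t)  ≡⟨ cong₂ _≤_ (proj₁ ranks≡) (rank-at-cong iso t<k) ⟩
    rank g k b ≤ rank g k (g t)  ≈⟨ ≤⇔rank≤ t<k ⟨
    b ≤ g t                      ∎

prefCodeAcc-child : ∀ acc xs u c rest → (u ∷ʳ c) ++ rest ≡ prefCodeAcc acc xs ∷ʳ dollar →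
                    c ≡ dollar ⊎
                    ∃[ ys ] ∃[ a ] a ∈ xs × u ≡ prefCodeAcc acc ys × c ≡ LastCode (acc ++ ys) a
prefCodeAcc-child acc []       []          c rest eq = inj₁ (∷-injectiveˡ eq)
prefCodeAcc-child acc []       (_ ∷ [])    c rest ()
prefCodeAcc-child acc []       (_ ∷ _ ∷ _) c rest ()
prefCodeAcc-child acc (x ∷ xs) []          c rest eq =
  inj₂ ([] , x , here refl , refl ,
        subst (λ l → c ≡ LastCode l x) (sym (++-identityʳ acc)) (∷-injectiveˡ eq))
prefCodeAcc-child acc (x ∷ xs) (y ∷ u)     c rest eq
  with prefCodeAcc-child (acc ∷ʳ x) xs u c rest (∷-injectiveʳ eq)
... | inj₁ c≡$ = inj₁ c≡$
... | inj₂ (ys , a , a∈xs , u≡ , c≡) = inj₂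
  (x ∷ ys , a , there a∈xs , cong₂ _∷_ (∷-injectiveˡ eq) u≡ ,
   trans c≡ (cong (λ l → LastCode l a) (∷ʳ-++ acc x ys)))

letter-< : ∀ {σ} {xs : List (Fin σ)} {a} → a ∈ map toℕ xs → a < σ
letter-< a∈ with ∈-map⁻ toℕ a∈
... | x , _ , refl = toℕ<n x

data EdgeSlot (σ : ℕ) (u : List Sym) : Sym → ℕ → Set where
  dollar-slot : EdgeSlot σ u dollar (2 * σ)
  code-slot   : ∀ {ys a n} → a < σ → u ≡ PrefCode ys → n ≡ slot (ys !_) (length ys) a →
                EdgeSlot σ u (LastCode ys a) n

edge-slot : ∀ {σ} (w : List (Fin σ)) {u c} → IsChild w u c → ∃[ n ] n < 2 * σ + 1 × EdgeSlot σ u c n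
edge-slot {σ} w (i , _ , rest , eq) with prefCodeAcc-child [] (map toℕ (drop i w)) _ _ rest eq
... | inj₁ refl = 2 * σ , m<m+n (2 * σ) z<s , dollar-slot
... | inj₂ (ys , a , a∈ , refl , refl) =
  slot (ys !_) (length ys) a , <-≤-trans (slot-< (letter-< a∈)) (m≤m+n (2 * σ) 1) ,
  code-slot (letter-< a∈) refl refl

edgeSlot-injective : ∀ {σ u c c′ n} → EdgeSlot σ u c n → EdgeSlot σ u c′ n → c ≡ c′
edgeSlot-injective dollar-slot dollar-slot = refl
edgeSlot-injective dollar-slot (code-slot a<σ _ 2σ≡) = contradiction (sym 2σ≡) (<⇒≢ (slot-< a<σ))
edgeSlot-injective (code-slot a<σ _ 2σ≡) dollar-slot = contradiction (sym 2σ≡) (<⇒≢ (slot-< a<σ))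
edgeSlot-injective (code-slot {ys} {a} _ u≡ys n≡) (code-slot {zs} {b} _ u≡zs n≡′) =
  from (lastCode-≡⇔samePlace ys≈zs) (slot-samePlace (length ys) (_≈_.orderIso ys≈zs) slots≡)
  where
  ys≈zs : ys ≈ zs
  ys≈zs = prefCode-≈ (trans (sym u≡ys) u≡zs)
  slots≡ : slot (ys !_) (length ys) a ≡ slot (zs !_) (length ys) b
  slots≡ = trans (sym n≡) (trans n≡′ (cong (λ k → slot (zs !_) k b) (sym (_≈_.length-≡ ys≈zs))))

unique-lookup-injective : ∀ {A : Set} {xs : List A} → Unique xs →
                          ∀ {i j} → lookup xs i ≡ lookup xs j → i ≡ j
unique-lookup-injective (_ ∷ _)      {Fin.zero}  {Fin.zero}  _  = refl
unique-lookup-injective (x∉xs ∷ _)   {Fin.zero}  {Fin.suc j} eq = contradiction eq (All.lookup x∉xs (∈-lookup j))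
unique-lookup-injective (x∉xs ∷ _)   {Fin.suc i} {Fin.zero}  eq =
  contradiction (sym eq) (All.lookup x∉xs (∈-lookup i))
unique-lookup-injective (_ ∷ unique) {Fin.suc i} {Fin.suc j} eq =
  cong Fin.suc (unique-lookup-injective unique eq)

module _ {A : Set} {R : A → ℕ → Set} (R-injective : ∀ {x y n} → R x n → R y n → x ≡ y) where

  length-≤-of-injective-labels : ∀ {m} {xs : List A} → Unique xs →
                                 All (λ x → ∃[ n ] n < m × R x n) xs → length xs ≤ m
  length-≤-of-injective-labels {m} {xs} unique labelled = injective⇒≤ label-injective
    where
    labelOf : (i : Fin (length xs)) → ∃[ n ] n < m × R (lookup xs i) n
    labelOf i = All.lookup labelled (∈-lookup i)
    label : Fin (length xs) → Fin m
    label i = fromℕ< (proj₁ (proj₂ (labelOf i)))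
    label-injective : ∀ {i j} → label i ≡ label j → i ≡ j
    label-injective {i} {j} eq = unique-lookup-injective unique
      (R-injective (proj₂ (proj₂ (labelOf i))) (subst (R (lookup xs j)) (sym n≡) (proj₂ (proj₂ (labelOf j)))))
      where
      n≡ : proj₁ (labelOf i) ≡ proj₁ (labelOf j)
      n≡ = trans (sym (toℕ-fromℕ< _)) (trans (cong toℕ eq) (toℕ-fromℕ< _))

-- The bound holds at every node.
lemma5 : ∀ {σ : ℕ} (w : List (Fin σ)) → w ≢ [] →
         (u : List Sym) → IsBranching w u →
         (cs : List Sym) → Unique cs → All (IsChild w u) cs →
         length cs ≤ 2 * σ + 1
lemma5 w _ u _ cs unique children =
  length-≤-of-injective-labels edgeSlot-injective unique (All.map (edge-slot w) children)
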